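{- Let $N$ be a power of 2 and consider recursive matrix multiplication of $N\times N$ matrices $A$ and $B$ (an $LN$ call). For every power of 2 $M$, let $RC(N,M)$ be the number of $LM$ reuses of any fixed item of $A$ or of $B$ within this call. Then $$RC(N,M)=\frac{N}{2M}.$$
   Context: Recursive matrix multiplication $\mathrm{rmm}(A,B)$ on $n\times n$ matrices, $n$ a power of 2, is defined as follows. If $n=1$ it computes $C_{11}=A_{11}B_{11}$, and this leaf is the only place elements of the original inputs are accessed. Otherwise it makes eight recursive calls on $\frac n2\times\frac n2$ blocks, in the order $(A_{11},B_{11}),(A_{12},B_{21}),(A_{11},B_{12}),(A_{12},B_{22}),(A_{21},B_{11}),(A_{22},B_{21}),(A_{21},B_{12}),(A_{22},B_{22})$, and sums consecutive pairs to form $C_{11},C_{12},C_{21},C_{22}$. The execution forms a tree: a node multiplying $X\times X$ matrices is an $LX$ node, each internal node has eight children, and execution is a depth-first left-to-right traversal. A reuse of an element of $A$ or $B$ is a pair of consecutive accesses to that element. Such a reuse is at level $LM$ if $M$ is the largest value for which some complete $LM$ call lies between the two accesses. For example, in a $4\times4$ multiplication the element $A[1,1]$ has two $L1$ reuses and one $L2$ reuse. -}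

module Defs where

open import Data.Nat using (ℕ; zero; suc; _+_; _*_; _^_; _⊔_; _≡ᵇ_)
open import Data.Bool using (Bool; true; false; if_then_else_; _∧_)
open import Data.List using (List; []; _∷_; _++_; length)
open import Data.Maybe using (Maybe; just; nothing)

data Mat : Set where
  A B : Mat

_≡Mat_ : Mat → Mat → Bool
A ≡Mat A = true
B ≡Mat B = true
_ ≡Mat _ = false

-- An item: matrix, row index, column index (0-based).
record Item : Set where
  constructor item
  field
    mat : Mat
    row : ℕ
    col : ℕ

_≡Item_ : Item → Item → Bool
item m i j ≡Item item m' i' j' = (m ≡Mat m') ∧ ((i ≡ᵇ i') ∧ (j ≡ᵇ j'))

-- Events of the depth-first execution trace.
-- enter k / leave k : start / end of an L(2^k) call (k is the exponent).
-- access x          : an access to the input element x (only at leaves).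
data Event : Set where
  enter  : ℕ → Event
  leave  : ℕ → Event
  access : Item → Event

-- Execution trace of an L(2^k) call multiplying the 2^k × 2^k block of A
-- with top-left corner (ai , aj) by the block of B with top-left corner (bi , bj).
rmm : ℕ → (ai aj bi bj : ℕ) → List Event
rmm zero ai aj bi bj =
  enter 0 ∷ access (item A ai aj) ∷ access (item B bi bj) ∷ leave 0 ∷ []
rmm (suc k) ai aj bi bj =
  enter (suc k) ∷
    (  rmm k ai       aj       bi       bj        -- (A11 , B11)
    ++ rmm k ai       (aj + h) (bi + h) bj        -- (A12 , B21)
    ++ rmm k ai       aj       bi       (bj + h)  -- (A11 , B12)
    ++ rmm k ai       (aj + h) (bi + h) (bj + h)  -- (A12 , B22)
    ++ rmm k (ai + h) aj       bi       bj        -- (A21 , B11)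
    ++ rmm k (ai + h) (aj + h) (bi + h) bj        -- (A22 , B21)
    ++ rmm k (ai + h) aj       bi       (bj + h)  -- (A21 , B12)
    ++ rmm k (ai + h) (aj + h) (bi + h) (bj + h)  -- (A22 , B22)
    ++ leave (suc k) ∷ [])
  where
    h = 2 ^ k

trace : ℕ → List Event
trace n = rmm n 0 0 0 0

isAccessOf : Item → Event → Bool
isAccessOf x (access y) = x ≡Item y
isAccessOf x _          = false

-- Segments of the trace strictly between consecutive accesses of x;
-- one segment per reuse of x.
-- State: nothing = x not yet accessed; just acc = events since last access.
gapsGo : Item → List Event → Maybe (List Event) → List (List Event)
gapsGo x [] _ = []
gapsGo x (e ∷ es) nothing =
  if isAccessOf x e then gapsGo x es (just []) else gapsGo x es nothing
gapsGo x (e ∷ es) (just acc) =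
  if isAccessOf x e then acc ∷ gapsGo x es (just [])
                    else gapsGo x es (just (acc ++ e ∷ []))

reuseGaps : Item → List Event → List (List Event)
reuseGaps x tr = gapsGo x tr nothing

isLeave : ℕ → Event → Bool
isLeave k (leave k') = k ≡ᵇ k'
isLeave k _          = false

hasLeave : ℕ → List Event → Bool
hasLeave k []       = false
hasLeave k (e ∷ es) = if isLeave k e then true else hasLeave k es

maxMaybe : Maybe ℕ → Maybe ℕ → Maybe ℕ
maxMaybe nothing  b        = b
maxMaybe (just a) nothing  = just a
maxMaybe (just a) (just b) = just (a ⊔ b)

-- Largest exponent k such that a complete L(2^k) call (its enter and its
-- leave event) lies inside the segment; nothing if there is none.
-- (Calls of equal level never nest, so an enter k followed later in the
-- segment by a leave k means the call started there is complete in it.)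
maxCompleteCall : List Event → Maybe ℕ
maxCompleteCall [] = nothing
maxCompleteCall (enter k ∷ es) =
  if hasLeave k es then maxMaybe (just k) (maxCompleteCall es)
                   else maxCompleteCall es
maxCompleteCall (_ ∷ es) = maxCompleteCall es

isLevel : ℕ → Maybe ℕ → Bool
isLevel m (just k) = m ≡ᵇ k
isLevel m nothing  = false

countLevel : ℕ → List (List Event) → ℕ
countLevel m []         = 0
countLevel m (s ∷ ss)   =
  if isLevel m (maxCompleteCall s) then suc (countLevel m ss) else countLevel m ss

-- RC n m x : number of L(2^m) reuses of item x within the L(2^n) call.
RC : ℕ → ℕ → Item → ℕ
RC n m x = countLevel m (reuseGaps x (trace n))

{-# OPTIONS --safe #-}
-- Fix an item x inside an L(2^(k+1)) call. Exactly two of its eight L(2^k) children access x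
-- (A_il is used by the children (i,0,l) and (i,1,l), B_lj by (0,j,l) and (1,j,l)), and between
-- them lies at least one complete sibling L(2^k) call but no larger one. So the reuses of x
-- are those inside the two children plus a single L(2^k) reuse:
-- RC(2^(k+1), M) = 2 RC(2^k, M) + [M = 2^k] and RC(1, M) = 0, whence RC(N, M) = N / 2M.
-- The reuse gaps are tracked compositionally: a piece of the trace either never accesses x, or
-- is summarised by what precedes its first access, the gaps between accesses, and what follows
-- its last access, and such summaries concatenate.
module Submission where

open import Defs
open import Data.Nat using (ℕ; _<_; _*_; _^_)
open import Data.Fin using (Fin; toℕ)
open import Relation.Binary.PropositionalEquality using (_≡_)

open import Data.Nat using (zero; suc; _+_; _≤_; _≡ᵇ_; z≤n)
open import Data.Nat.Properties
open import Data.Bool using (Bool; true; false; not; if_then_else_)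
open import Data.Bool.Properties using (∧-zeroʳ; ¬-not) renaming (_≟_ to _≟ᵇ_)
open import Data.List using (List; []; _∷_; _++_)
open import Data.List.Properties using (++-assoc; ++-identityʳ)
open import Data.List.Relation.Unary.All using (All; []; _∷_) renaming (map to All-map)
open import Data.List.Relation.Unary.All.Properties using (++⁺)
open import Data.Maybe using (Maybe; just; nothing)
open import Data.Maybe.Relation.Unary.All as MaybeAll using (just; nothing)
open import Data.Maybe.Relation.Unary.Any as MaybeAny using (just)
open import Data.Fin.Properties using (toℕ<n)
open import Data.Empty using (⊥)
open import Data.Unit using (⊤; tt)
open import Data.Product using (Σ-syntax; _×_; _,_; proj₁)
open import Data.Sum using (_⊎_; inj₁; inj₂) renaming (map to ⊎-map)
open import Function using (_∘_; id)
open import Relation.Binary.PropositionalEquality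
  using (_≢_; refl; sym; trans; cong; cong₂; subst; ≢-sym; module ≡-Reasoning)
open import Relation.Nullary using (yes; no; contradiction)

variable
  x : Item
  k m n a r : ℕ
  T T₁ T₂ : List Event

≡ᵇ-refl : ∀ n → (n ≡ᵇ n) ≡ true
≡ᵇ-refl zero    = refl
≡ᵇ-refl (suc n) = ≡ᵇ-refl n

≢⇒≡ᵇ-false : ∀ {m n} → m ≢ n → (m ≡ᵇ n) ≡ false
≢⇒≡ᵇ-false {zero}  {zero}  m≢n = contradiction refl m≢n
≢⇒≡ᵇ-false {zero}  {suc n} _   = refl
≢⇒≡ᵇ-false {suc m} {zero}  _   = refl
≢⇒≡ᵇ-false {suc m} {suc n} m≢n = ≢⇒≡ᵇ-false (m≢n ∘ cong suc)

≡Mat-refl : ∀ X → (X ≡Mat X) ≡ true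
≡Mat-refl A = refl
≡Mat-refl B = refl

≡Item-refl : ∀ x → (x ≡Item x) ≡ true
≡Item-refl (item X i j) rewrite ≡Mat-refl X | ≡ᵇ-refl i | ≡ᵇ-refl j = refl

≡Item-false : ∀ X {r c r′ c′} → r ≢ r′ ⊎ c ≢ c′ → (item X r c ≡Item item X r′ c′) ≡ false
≡Item-false X (inj₁ r≢r′) rewrite ≡Mat-refl X | ≢⇒≡ᵇ-false r≢r′ = refl
≡Item-false X {r} {r′ = r′} (inj₂ c≢c′) rewrite ≡Mat-refl X | ≢⇒≡ᵇ-false c≢c′ = ∧-zeroʳ (r ≡ᵇ r′)

EnterLe : ℕ → Event → Set
EnterLe k (enter j) = j ≤ k
EnterLe k _         = ⊤

EntersLe : ℕ → List Event → Set
EntersLe k = All (EnterLe k)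

EnterLe-suc : ∀ {e} → EnterLe k e → EnterLe (suc k) e
EnterLe-suc {e = enter _}  j≤k = m≤n⇒m≤1+n j≤k
EnterLe-suc {e = leave _}  _   = tt
EnterLe-suc {e = access _} _   = tt

EntersLe-suc : EntersLe k T → EntersLe (suc k) T
EntersLe-suc = All-map EnterLe-suc

NoAccess : Item → List Event → Set
NoAccess x = All (λ e → isAccessOf x e ≡ false)

half : ℕ → Bool → ℕ → ℕ
half k false a = a
half k true  a = a + 2 ^ k

-- Child (i , j , l) of an L(2^(k+1)) call multiplies A_il by B_lj;
-- the eight children run in lexicographic order of (i , j , l).
kid : (k ai aj bi bj : ℕ) (i j l : Bool) → List Event
kid k ai aj bi bj i j l = rmm k (half k i ai) (half k l aj) (half k l bi) (half k j bj)

All-rmm-suc : ∀ {P : Event → Set} k ai aj bi bj → P (enter (suc k)) → P (leave (suc k)) →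
  (∀ i j l → All P (kid k ai aj bi bj i j l)) → All P (rmm (suc k) ai aj bi bj)
All-rmm-suc k ai aj bi bj p-enter p-leave p =
  p-enter ∷ ++⁺ (p false false false) (++⁺ (p false false true) (++⁺ (p false true false)
    (++⁺ (p false true true) (++⁺ (p true false false) (++⁺ (p true false true)
    (++⁺ (p true true false) (++⁺ (p true true true) (p-leave ∷ []))))))))

rmm-entersLe : ∀ k ai aj bi bj → EntersLe k (rmm k ai aj bi bj)
rmm-entersLe zero    _  _  _  _  = z≤n ∷ tt ∷ tt ∷ tt ∷ []
rmm-entersLe (suc k) ai aj bi bj =
  All-rmm-suc k ai aj bi bj ≤-refl tt (λ _ _ _ → EntersLe-suc (rmm-entersLe k _ _ _ _))

EntersLe-rmm-++ : ∀ {ai aj bi bj} → EntersLe k T → EntersLe k (rmm k ai aj bi bj ++ T)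
EntersLe-rmm-++ = ++⁺ (rmm-entersLe _ _ _ _ _)

InBlock OutBlock : ℕ → ℕ → ℕ → Set
InBlock  k a r = a ≤ r × r < a + 2 ^ k
OutBlock k a r = r < a ⊎ a + 2 ^ k ≤ r

+-2^-double : ∀ k a → a + 2 ^ k + 2 ^ k ≡ a + 2 ^ suc k
+-2^-double k a = trans (+-assoc a (2 ^ k) (2 ^ k)) (cong (λ t → a + (2 ^ k + t)) (sym (+-identityʳ (2 ^ k))))

OutBlock-half : ∀ b → OutBlock (suc k) a r → OutBlock k (half k b a) r
OutBlock-half         false (inj₁ r<a)   = inj₁ r<a
OutBlock-half {k} {a} false (inj₂ end≤r) = inj₂ (≤-trans (+-monoʳ-≤ a (m≤m+n (2 ^ k) _)) end≤r)
OutBlock-half {k} {a} true  (inj₁ r<a)   = inj₁ (<-≤-trans r<a (m≤m+n a (2 ^ k)))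
OutBlock-half {k} {a} {r} true (inj₂ end≤r) = inj₂ (subst (_≤ r) (sym (+-2^-double k a)) end≤r)

InBlock-zero : InBlock 0 a r → r ≡ a
InBlock-zero {a} {r} (a≤r , r<a+1) = ≤-antisym (m<1+n⇒m≤n (subst (r <_) (+-comm a 1) r<a+1)) a≤r

OutBlock-zero : OutBlock 0 a r → r ≢ a
OutBlock-zero           (inj₁ r<a)   = <⇒≢ r<a
OutBlock-zero {a} {r} (inj₂ a+1≤r) = ≢-sym (<⇒≢ (subst (_≤ r) (+-comm a 1) a+1≤r))

record WhichHalf (k a r : ℕ) : Set where
  constructor in-half
  field
    side    : Bool
    inside  : InBlock  k (half k side a) r
    outside : OutBlock k (half k (not side) a) r

whichHalf : InBlock (suc k) a r → WhichHalf k a r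
whichHalf {k} {a} {r} (a≤r , r<end) with r <? a + 2 ^ k
... | yes r<mid = in-half false (a≤r , r<mid) (inj₁ r<mid)
... | no  r≮mid = in-half true (≮⇒≥ r≮mid , subst (r <_) (sym (+-2^-double k a)) r<end) (inj₂ (≮⇒≥ r≮mid))

OutBlock-other : ∀ {b p} → b ≢ p → OutBlock k (half k (not p) a) r → OutBlock k (half k b a) r
OutBlock-other {k} {a} {r} b≢p = subst (λ b → OutBlock k (half k b a) r) (sym (¬-not b≢p))

rowCorner colCorner : Mat → (ai aj bi bj : ℕ) → ℕ
rowCorner A ai aj bi bj = ai
rowCorner B ai aj bi bj = bi
colCorner A ai aj bi bj = aj
colCorner B ai aj bi bj = bj

kidRow kidCol : Mat → (i j l : Bool) → Bool
kidRow A i j l = i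
kidRow B i j l = l
kidCol A i j l = l
kidCol B i j l = j

Inside Outside : ℕ → Mat → (ai aj bi bj r c : ℕ) → Set
Inside  k X ai aj bi bj r c = InBlock  k (rowCorner X ai aj bi bj) r × InBlock  k (colCorner X ai aj bi bj) c
Outside k X ai aj bi bj r c = OutBlock k (rowCorner X ai aj bi bj) r ⊎ OutBlock k (colCorner X ai aj bi bj) c

module Kid (k ai aj bi bj r c : ℕ) where

  InsideKid OutsideKid : Mat → (i j l : Bool) → Set
  InsideKid  X i j l = Inside  k X (half k i ai) (half k l aj) (half k l bi) (half k j bj) r c
  OutsideKid X i j l = Outside k X (half k i ai) (half k l aj) (half k l bi) (half k j bj) r c

  inside-kid : ∀ X i j l →
    InBlock k (half k (kidRow X i j l) (rowCorner X ai aj bi bj)) r →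
    InBlock k (half k (kidCol X i j l) (colCorner X ai aj bi bj)) c → InsideKid X i j l
  inside-kid A _ _ _ r∈ c∈ = r∈ , c∈
  inside-kid B _ _ _ r∈ c∈ = r∈ , c∈

  outside-kid : ∀ X i j l →
    OutBlock k (half k (kidRow X i j l) (rowCorner X ai aj bi bj)) r ⊎
    OutBlock k (half k (kidCol X i j l) (colCorner X ai aj bi bj)) c → OutsideKid X i j l
  outside-kid A _ _ _ out = out
  outside-kid B _ _ _ out = out

noAccess : ∀ X k ai aj bi bj r c → Outside k X ai aj bi bj r c → NoAccess (item X r c) (rmm k ai aj bi bj)
noAccess A zero _ _ _ _ _ _ out = refl ∷ ≡Item-false A (⊎-map OutBlock-zero OutBlock-zero out) ∷ refl ∷ refl ∷ []
noAccess B zero _ _ _ _ _ _ out = refl ∷ refl ∷ ≡Item-false B (⊎-map OutBlock-zero OutBlock-zero out) ∷ refl ∷ []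
noAccess X (suc k) ai aj bi bj r c out = All-rmm-suc k ai aj bi bj refl refl λ i j l →
  noAccess X k _ _ _ _ r c (Kid.outside-kid k ai aj bi bj r c X i j l
    (⊎-map (OutBlock-half (kidRow X i j l)) (OutBlock-half (kidCol X i j l)) out))

advance : Maybe (List Event) → List Event → Maybe (List Event)
advance nothing    _ = nothing
advance (just acc) T = just (acc ++ T)

closing : Maybe (List Event) → List Event → List (List Event)
closing nothing    _ = []
closing (just acc) T = (acc ++ T) ∷ []

closing-advance : ∀ s T₁ T₂ → closing (advance s T₁) T₂ ≡ closing s (T₁ ++ T₂)
closing-advance nothing    _  _  = refl
closing-advance (just acc) T₁ T₂ = cong (_∷ []) (++-assoc acc T₁ T₂)

gapsGo-silent : ∀ x {T} rest s → NoAccess x T → gapsGo x (T ++ rest) s ≡ gapsGo x rest (advance s T)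
gapsGo-silent x rest nothing    [] = refl
gapsGo-silent x rest (just acc) [] = cong (gapsGo x rest ∘ just) (sym (++-identityʳ acc))
gapsGo-silent x rest nothing    (e∉ ∷ T∉) rewrite e∉ = gapsGo-silent x rest nothing T∉
gapsGo-silent x {e ∷ T} rest (just acc) (e∉ ∷ T∉) rewrite e∉ =
  trans (gapsGo-silent x rest (just (acc ++ e ∷ [])) T∉) (cong (gapsGo x rest ∘ just) (++-assoc acc (e ∷ []) T))

gapsGo-reassoc : ∀ x T₁ T₂ rest s → gapsGo x ((T₁ ++ T₂) ++ rest) s ≡ gapsGo x (T₁ ++ T₂ ++ rest) s
gapsGo-reassoc x T₁ T₂ rest s = cong (λ t → gapsGo x t s) (++-assoc T₁ T₂ rest)

-- before / after: the events of T preceding the first / following the last access of x;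
-- inner: the gaps between consecutive accesses of x inside T.
record Accessed (x : Item) (k : ℕ) (T : List Event) : Set where
  field
    before after : List Event
    inner        : List (List Event)
    gapsGo-++    : ∀ rest s → gapsGo x (T ++ rest) s ≡ closing s before ++ inner ++ gapsGo x rest (just after)
    before-≤     : EntersLe k before
    after-≤      : EntersLe k after

open Accessed

data Seg (x : Item) (k : ℕ) (T : List Event) : Set where
  silent   : NoAccess x T → EntersLe k T → Seg x k T
  accessed : Accessed x k T → Seg x k T

single : Accessed x k (access x ∷ [])
single {x} = record
  { before = [] ; after = [] ; inner = [] ; gapsGo-++ = gaps ; before-≤ = [] ; after-≤ = [] }
  where
    gaps : ∀ rest s → gapsGo x (access x ∷ rest) s ≡ closing s [] ++ gapsGo x rest (just [])
    gaps rest nothing    rewrite ≡Item-refl x = refl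
    gaps rest (just acc) rewrite ≡Item-refl x = cong (λ g → g ∷ gapsGo x rest (just [])) (sym (++-identityʳ acc))

weaken : Seg x k T → Seg x (suc k) T
weaken (silent T∉ T≤)  = silent T∉ (EntersLe-suc T≤)
weaken (accessed o) = accessed record
  { before = before o ; after = after o ; inner = inner o ; gapsGo-++ = gapsGo-++ o
  ; before-≤ = EntersLe-suc (before-≤ o) ; after-≤ = EntersLe-suc (after-≤ o) }

silent-++ : NoAccess x T₁ → EntersLe k T₁ → Accessed x k T₂ → Accessed x k (T₁ ++ T₂)
silent-++ {x} {T₁} {T₂ = T₂} T₁∉ T₁≤ o = record
  { before = T₁ ++ before o ; after = after o ; inner = inner o
  ; gapsGo-++ = λ rest s → begin
      gapsGo x ((T₁ ++ T₂) ++ rest) s                 ≡⟨ gapsGo-reassoc x T₁ T₂ rest s ⟩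
      gapsGo x (T₁ ++ T₂ ++ rest) s                   ≡⟨ gapsGo-silent x (T₂ ++ rest) s T₁∉ ⟩
      gapsGo x (T₂ ++ rest) (advance s T₁)            ≡⟨ gapsGo-++ o rest (advance s T₁) ⟩
      closing (advance s T₁) (before o) ++ _          ≡⟨ cong (_++ _) (closing-advance s T₁ (before o)) ⟩
      closing s (T₁ ++ before o) ++ _                 ∎
  ; before-≤ = ++⁺ T₁≤ (before-≤ o) ; after-≤ = after-≤ o }
  where open ≡-Reasoning

++-silent : Accessed x k T₁ → NoAccess x T₂ → EntersLe k T₂ → Accessed x k (T₁ ++ T₂)
++-silent {x} {T₁ = T₁} {T₂} o T₂∉ T₂≤ = record
  { before = before o ; after = after o ++ T₂ ; inner = inner o
  ; gapsGo-++ = λ rest s → begin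
      gapsGo x ((T₁ ++ T₂) ++ rest) s                 ≡⟨ gapsGo-reassoc x T₁ T₂ rest s ⟩
      gapsGo x (T₁ ++ T₂ ++ rest) s                   ≡⟨ gapsGo-++ o (T₂ ++ rest) s ⟩
      closing s (before o) ++ inner o ++ gapsGo x (T₂ ++ rest) (just (after o))
        ≡⟨ cong (λ g → closing s (before o) ++ inner o ++ g) (gapsGo-silent x rest (just (after o)) T₂∉) ⟩
      closing s (before o) ++ inner o ++ gapsGo x rest (just (after o ++ T₂)) ∎
  ; before-≤ = before-≤ o ; after-≤ = ++⁺ (after-≤ o) T₂≤ }
  where open ≡-Reasoning

join : Accessed x k T₁ → Accessed x k T₂ → Accessed x k (T₁ ++ T₂)
join {x} {T₁ = T₁} {T₂} o₁ o₂ = record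
  { before = before o₁ ; after = after o₂ ; inner = inner o₁ ++ gap ∷ inner o₂
  ; gapsGo-++ = λ rest s → begin
      gapsGo x ((T₁ ++ T₂) ++ rest) s                 ≡⟨ gapsGo-reassoc x T₁ T₂ rest s ⟩
      gapsGo x (T₁ ++ T₂ ++ rest) s                   ≡⟨ gapsGo-++ o₁ (T₂ ++ rest) s ⟩
      closing s (before o₁) ++ inner o₁ ++ gapsGo x (T₂ ++ rest) (just (after o₁))
        ≡⟨ cong (λ g → closing s (before o₁) ++ inner o₁ ++ g) (gapsGo-++ o₂ rest (just (after o₁))) ⟩
      closing s (before o₁) ++ inner o₁ ++ gap ∷ inner o₂ ++ gapsGo x rest (just (after o₂))
        ≡⟨ cong (closing s (before o₁) ++_) (sym (++-assoc (inner o₁) (gap ∷ inner o₂) _)) ⟩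
      closing s (before o₁) ++ (inner o₁ ++ gap ∷ inner o₂) ++ gapsGo x rest (just (after o₂)) ∎
  ; before-≤ = before-≤ o₁ ; after-≤ = after-≤ o₂ }
  where
    open ≡-Reasoning
    gap : List Event
    gap = after o₁ ++ before o₂

infixr 5 _⊕_
_⊕_ : Seg x k T₁ → Seg x k T₂ → Seg x k (T₁ ++ T₂)
silent T₁∉ T₁≤ ⊕ silent T₂∉ T₂≤ = silent (++⁺ T₁∉ T₂∉) (++⁺ T₁≤ T₂≤)
silent T₁∉ T₁≤ ⊕ accessed o₂    = accessed (silent-++ T₁∉ T₁≤ o₂)
accessed o₁    ⊕ silent T₂∉ T₂≤ = accessed (++-silent o₁ T₂∉ T₂≤)
accessed o₁    ⊕ accessed o₂    = accessed (join o₁ o₂)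

reuseGaps-inner : (o : Accessed x k T) → reuseGaps x T ≡ inner o
reuseGaps-inner {x} {T = T} o = begin
  gapsGo x T nothing          ≡⟨ cong (λ t → gapsGo x t nothing) (sym (++-identityʳ T)) ⟩
  gapsGo x (T ++ []) nothing  ≡⟨ gapsGo-++ o [] nothing ⟩
  inner o ++ []               ≡⟨ ++-identityʳ (inner o) ⟩
  inner o                     ∎
  where open ≡-Reasoning

hasLeave-++ˡ : ∀ j xs ys → hasLeave j xs ≡ true → hasLeave j (xs ++ ys) ≡ true
hasLeave-++ˡ j (e ∷ xs) ys h with isLeave j e
... | true  = refl
... | false = hasLeave-++ˡ j xs ys h

hasLeave-++ʳ : ∀ j xs {ys} → hasLeave j ys ≡ true → hasLeave j (xs ++ ys) ≡ true
hasLeave-++ʳ j []       h = h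
hasLeave-++ʳ j (e ∷ xs) h with isLeave j e
... | true  = refl
... | false = hasLeave-++ʳ j xs h

hasLeave-leave : ∀ k xs → hasLeave k (leave k ∷ xs) ≡ true
hasLeave-leave k xs rewrite ≡ᵇ-refl k = refl

rmm-complete : ∀ k ai aj bi bj →
  Σ[ V ∈ List Event ] (rmm k ai aj bi bj ≡ enter k ∷ V) × hasLeave k V ≡ true
rmm-complete zero    _  _  _  _  = _ , refl , refl
rmm-complete (suc k) ai aj bi bj = _ , refl ,
  skipKid false false false (skipKid false false true (skipKid false true false (skipKid false true true
  (skipKid true false false (skipKid true false true (skipKid true true false (skipKid true true true
  (hasLeave-leave (suc k) []))))))))
  where
    skipKid : ∀ i j l {ys} → hasLeave (suc k) ys ≡ true → hasLeave (suc k) (kid k ai aj bi bj i j l ++ ys) ≡ true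
    skipKid i j l = hasLeave-++ʳ (suc k) (kid k ai aj bi bj i j l)

maxMaybe-≤ : ∀ {a b} → MaybeAll.All (_≤ k) a → MaybeAll.All (_≤ k) b → MaybeAll.All (_≤ k) (maxMaybe a b)
maxMaybe-≤ nothing  b≤       = b≤
maxMaybe-≤ (just p) nothing  = just p
maxMaybe-≤ (just p) (just q) = just (⊔-lub p q)

maxMaybe-≥ʳ : ∀ a {b} → MaybeAny.Any (k ≤_) b → MaybeAny.Any (k ≤_) (maxMaybe a b)
maxMaybe-≥ʳ nothing  k≤b      = k≤b
maxMaybe-≥ʳ (just a) (just q) = just (≤-trans q (m≤n⊔m a _))

maxMaybe-≥ˡ : ∀ k b → MaybeAny.Any (k ≤_) (maxMaybe (just k) b)
maxMaybe-≥ˡ k nothing  = just ≤-refl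
maxMaybe-≥ˡ k (just b) = just (m≤m⊔n k b)

maxCompleteCall-≤ : ∀ L → EntersLe k L → MaybeAll.All (_≤ k) (maxCompleteCall L)
maxCompleteCall-≤ []              []       = nothing
maxCompleteCall-≤ (enter j ∷ es)  (p ∷ ps) with hasLeave j es
... | true  = maxMaybe-≤ (just p) (maxCompleteCall-≤ es ps)
... | false = maxCompleteCall-≤ es ps
maxCompleteCall-≤ (leave _ ∷ es)  (_ ∷ ps) = maxCompleteCall-≤ es ps
maxCompleteCall-≤ (access _ ∷ es) (_ ∷ ps) = maxCompleteCall-≤ es ps

maxCompleteCall-≥ : ∀ {V} → hasLeave k V ≡ true → ∀ U → MaybeAny.Any (k ≤_) (maxCompleteCall (U ++ enter k ∷ V))
maxCompleteCall-≥ {k} {V} h [] rewrite h = maxMaybe-≥ˡ k (maxCompleteCall V)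
maxCompleteCall-≥ {k} {V} h (enter j ∷ U) with hasLeave j (U ++ enter k ∷ V)
... | true  = maxMaybe-≥ʳ (just j) (maxCompleteCall-≥ h U)
... | false = maxCompleteCall-≥ h U
maxCompleteCall-≥ h (leave _ ∷ U)  = maxCompleteCall-≥ h U
maxCompleteCall-≥ h (access _ ∷ U) = maxCompleteCall-≥ h U

≤-≥⇒≡just : ∀ {a} → MaybeAll.All (_≤ k) a → MaybeAny.Any (k ≤_) a → a ≡ just k
≤-≥⇒≡just (just a≤k) (just k≤a) = cong just (≤-antisym a≤k k≤a)

call-gap-level : ∀ {ai aj bi bj} P Q → EntersLe k P → EntersLe k Q →
  maxCompleteCall (P ++ rmm k ai aj bi bj ++ Q) ≡ just k
call-gap-level {k} {ai} {aj} {bi} {bj} P Q P≤ Q≤ with rmm-complete k ai aj bi bj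
... | V , call≡ , h = ≤-≥⇒≡just
  (maxCompleteCall-≤ _ (++⁺ P≤ (EntersLe-rmm-++ Q≤)))
  (subst (λ t → MaybeAny.Any (k ≤_) (maxCompleteCall (P ++ t ++ Q))) (sym call≡)
    (maxCompleteCall-≥ (hasLeave-++ˡ k V Q h) P))

atLevel : ℕ → List Event → ℕ
atLevel m g = if isLevel m (maxCompleteCall g) then 1 else 0

countLevel-∷ : ∀ m g gs → countLevel m (g ∷ gs) ≡ atLevel m g + countLevel m gs
countLevel-∷ m g gs with isLevel m (maxCompleteCall g)
... | true  = refl
... | false = refl

countLevel-++ : ∀ m gs hs → countLevel m (gs ++ hs) ≡ countLevel m gs + countLevel m hs
countLevel-++ m []       hs = refl
countLevel-++ m (g ∷ gs) hs
  rewrite countLevel-∷ m g (gs ++ hs) | countLevel-∷ m g gs | countLevel-++ m gs hs =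
  sym (+-assoc (atLevel m g) _ _)

-- reuses k m : number of L(2^m) reuses of an item within an L(2^k) call containing it.
reuses : ℕ → ℕ → ℕ
reuses zero    m = 0
reuses (suc k) m = reuses k m + ((if m ≡ᵇ k then 1 else 0) + reuses k m)

reuses-≤ : n ≤ m → reuses n m ≡ 0
reuses-≤ {zero}  _   = refl
reuses-≤ {suc k} {m} k<m rewrite ≢⇒≡ᵇ-false (≢-sym (<⇒≢ k<m)) | reuses-≤ {k} {m} (<⇒≤ k<m) = refl

reuses-closed-form : m < n → reuses n m * (2 * 2 ^ m) ≡ 2 ^ n
reuses-closed-form {m} {suc k} m<1+k with m ≟ k
... | yes refl rewrite ≡ᵇ-refl m | reuses-≤ {m} {m} ≤-refl = +-identityʳ _
... | no  m≢k  rewrite ≢⇒≡ᵇ-false m≢k = begin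
    (reuses k m + reuses k m) * (2 * 2 ^ m)                ≡⟨ *-distribʳ-+ (2 * 2 ^ m) (reuses k m) _ ⟩
    reuses k m * (2 * 2 ^ m) + reuses k m * (2 * 2 ^ m)    ≡⟨ cong₂ _+_ ih ih ⟩
    2 ^ k + 2 ^ k                                          ≡⟨ cong (2 ^ k +_) (sym (+-identityʳ (2 ^ k))) ⟩
    2 ^ suc k                                              ∎
  where
    open ≡-Reasoning
    ih : reuses k m * (2 * 2 ^ m) ≡ 2 ^ k
    ih = reuses-closed-form (≤∧≢⇒< (m<1+n⇒m≤n m<1+k) m≢k)

CallLike : Item → ℕ → List Event → Set
CallLike x k T = Σ[ o ∈ Accessed x k T ] ∀ m → countLevel m (inner o) ≡ reuses k m

Counted : Seg x k T → Set
Counted               (silent _ _) = ⊥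
Counted {x} {k} {T} (accessed o)   = ∀ m → countLevel m (inner o) ≡ reuses k m

toCallLike : (s : Seg x k T) → Counted s → CallLike x k T
toCallLike (accessed o) counted = o , counted

countLevel-CallLike : CallLike x k T → countLevel m (reuseGaps x T) ≡ reuses k m
countLevel-CallLike {m = m} (o , counted) = trans (cong (countLevel m) (reuseGaps-inner o)) (counted m)

twoAccesses : ∀ {ai aj bi bj Q} (c₁ : CallLike x k T₁) (c₂ : CallLike x k T₂) →
  (EntersLe k (before (proj₁ c₂)) → EntersLe k Q) → ∀ m →
  countLevel m (inner (proj₁ c₁) ++ (after (proj₁ c₁) ++ rmm k ai aj bi bj ++ Q) ∷ inner (proj₁ c₂))
    ≡ reuses (suc k) m
twoAccesses {k = k} {ai = ai} {aj} {bi} {bj} {Q} (o₁ , counted₁) (o₂ , counted₂) Q≤ m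
  rewrite countLevel-++ m (inner o₁) ((after o₁ ++ rmm k ai aj bi bj ++ Q) ∷ inner o₂)
        | countLevel-∷ m (after o₁ ++ rmm k ai aj bi bj ++ Q) (inner o₂)
        | call-gap-level {ai = ai} {aj} {bi} {bj} (after o₁) Q (after-≤ o₁) (Q≤ (before-≤ o₂))
        | counted₁ m | counted₂ m = refl

module _ (k ai aj bi bj r c : ℕ) where
  open Kid k ai aj bi bj r c

  KidsCallLike : Mat → Set
  KidsCallLike X = ∀ i j l → InsideKid X i j l → CallLike (item X r c) k (kid k ai aj bi bj i j l)

  kidSeg : ∀ X → WhichHalf k (rowCorner X ai aj bi bj) r → WhichHalf k (colCorner X ai aj bi bj) c →
    KidsCallLike X → ∀ i j l → Seg (item X r c) k (kid k ai aj bi bj i j l)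
  kidSeg X (in-half p r∈ r∉) (in-half q c∈ c∉) ih i j l with kidRow X i j l ≟ᵇ p | kidCol X i j l ≟ᵇ q
  ... | yes refl | yes refl = accessed (proj₁ (ih i j l (inside-kid X i j l r∈ c∈)))
  ... | no  i≢p  | _        = silent (noAccess X k _ _ _ _ r c (outside-kid X i j l (inj₁ (OutBlock-other i≢p r∉))))
                                     (rmm-entersLe k _ _ _ _)
  ... | yes _    | no  j≢q  = silent (noAccess X k _ _ _ _ r c (outside-kid X i j l (inj₂ (OutBlock-other j≢q c∉))))
                                     (rmm-entersLe k _ _ _ _)

  nodeSeg : ∀ X → WhichHalf k (rowCorner X ai aj bi bj) r → WhichHalf k (colCorner X ai aj bi bj) c →
    KidsCallLike X → Seg (item X r c) (suc k) (rmm (suc k) ai aj bi bj)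
  nodeSeg X rh ch ih = silent (refl ∷ []) (≤-refl ∷ []) ⊕ weaken
    (s false false false ⊕ s false false true ⊕ s false true false ⊕ s false true true ⊕
     s true  false false ⊕ s true  false true ⊕ s true  true false ⊕ s true  true true ⊕
     silent (refl ∷ []) (tt ∷ []))
    where
      s : ∀ i j l → Seg (item X r c) k (kid k ai aj bi bj i j l)
      s = kidSeg X rh ch ih

  nodeCounted : ∀ X rh ch ih → Counted (nodeSeg X rh ch ih)
  nodeCounted A (in-half false r∈ _) (in-half false c∈ _) ih =
    twoAccesses (ih false false false (r∈ , c∈)) (ih false true false (r∈ , c∈)) id
  nodeCounted A (in-half false r∈ _) (in-half true c∈ _) ih =
    twoAccesses (ih false false true (r∈ , c∈)) (ih false true true (r∈ , c∈)) id
  nodeCounted A (in-half true r∈ _) (in-half false c∈ _) ih =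
    twoAccesses (ih true false false (r∈ , c∈)) (ih true true false (r∈ , c∈)) id
  nodeCounted A (in-half true r∈ _) (in-half true c∈ _) ih =
    twoAccesses (ih true false true (r∈ , c∈)) (ih true true true (r∈ , c∈)) id
  nodeCounted B (in-half false r∈ _) (in-half false c∈ _) ih =
    twoAccesses (ih false false false (r∈ , c∈)) (ih true false false (r∈ , c∈)) (EntersLe-rmm-++ ∘ EntersLe-rmm-++)
  nodeCounted B (in-half false r∈ _) (in-half true c∈ _) ih =
    twoAccesses (ih false true false (r∈ , c∈)) (ih true true false (r∈ , c∈)) (EntersLe-rmm-++ ∘ EntersLe-rmm-++)
  nodeCounted B (in-half true r∈ _) (in-half false c∈ _) ih =
    twoAccesses (ih false false true (r∈ , c∈)) (ih true false true (r∈ , c∈)) (EntersLe-rmm-++ ∘ EntersLe-rmm-++)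
  nodeCounted B (in-half true r∈ _) (in-half true c∈ _) ih =
    twoAccesses (ih false true true (r∈ , c∈)) (ih true true true (r∈ , c∈)) (EntersLe-rmm-++ ∘ EntersLe-rmm-++)

leaf : ∀ X ai aj bi bj → CallLike (item X (rowCorner X ai aj bi bj) (colCorner X ai aj bi bj)) 0 (rmm 0 ai aj bi bj)
leaf A _ _ _ _ = toCallLike
  (silent (refl ∷ []) (z≤n ∷ []) ⊕ accessed single ⊕ silent (refl ∷ refl ∷ []) (tt ∷ tt ∷ [])) λ _ → refl
leaf B _ _ _ _ = toCallLike
  (silent (refl ∷ refl ∷ []) (z≤n ∷ tt ∷ []) ⊕ accessed single ⊕ silent (refl ∷ []) (tt ∷ [])) λ _ → refl

callLike : ∀ X k ai aj bi bj r c → Inside k X ai aj bi bj r c → CallLike (item X r c) k (rmm k ai aj bi bj)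
callLike X zero ai aj bi bj r c (r∈ , c∈) rewrite InBlock-zero r∈ | InBlock-zero c∈ = leaf X ai aj bi bj
callLike X (suc k) ai aj bi bj r c (r∈ , c∈) =
  toCallLike (nodeSeg k ai aj bi bj r c X (whichHalf r∈) (whichHalf c∈) ih)
             (nodeCounted k ai aj bi bj r c X (whichHalf r∈) (whichHalf c∈) ih)
  where
    ih : KidsCallLike k ai aj bi bj r c X
    ih i j l = callLike X k _ _ _ _ r c

inside-trace : ∀ X {n r c} → r < 2 ^ n → c < 2 ^ n → Inside n X 0 0 0 0 r c
inside-trace A r< c< = (z≤n , r<) , (z≤n , c<)
inside-trace B r< c< = (z≤n , r<) , (z≤n , c<)

lemma4 : (n m : ℕ) → m < n → (X : Mat) (i j : Fin (2 ^ n)) →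
    RC n m (item X (toℕ i) (toℕ j)) * (2 * 2 ^ m) ≡ 2 ^ n
lemma4 n m m<n X i j = begin
  RC n m (item X (toℕ i) (toℕ j)) * (2 * 2 ^ m)  ≡⟨ cong (_* (2 * 2 ^ m)) (countLevel-CallLike call) ⟩
  reuses n m * (2 * 2 ^ m)                        ≡⟨ reuses-closed-form m<n ⟩
  2 ^ n                                           ∎
  where
    open ≡-Reasoning
    call : CallLike (item X (toℕ i) (toℕ j)) n (trace n)
    call = callLike X n 0 0 0 0 _ _ (inside-trace X {n} (toℕ<n i) (toℕ<n j))
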